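{- Let $\mathcal{C}=\{c_1,\ldots,c_m\}$ be a collection of cliques with graph union $U$ on vertex set $V$, and let $H\subseteq V$ induce a clique in $U$, with support $\mathcal{F}_H=S(H)$. Let $S(G)=\{J:\Gamma_J\neq\emptyset\}$ and let $\mathcal{M}_H$ be the set of all maximal intersecting families $\mathcal{F}$ on $S(G)$ with $\mathcal{F}_H\subseteq\mathcal{F}$. For a family $\mathcal{F}$ of subsets of $\{1,\ldots,m\}$ let $N(\mathcal{F})=\sum_{J\in\mathcal{F}}\gamma_J$. Then the number of cliques of $U$ containing $H$ (including $H$ itself) is \[ 1+\sum_{\emptyset\neq\mathcal{J}\subseteq\mathcal{M}_H}(-1)^{|\mathcal{J}|+1}\left(2^{\,N\left(\bigcap_{\mathcal{F}\in\mathcal{J}}\mathcal{F}\right)-|H|}-1\right). \]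
   Context: A clique is identified with its vertex set. The graph union $U$ of $c_1,\ldots,c_m$ has vertex set $V=\bigcup_j c_j$, and distinct $u,v\in V$ are adjacent iff $u,v\in c_j$ for some $j$. For $J\subseteq\{1,\ldots,m\}$, $\Gamma_J$ is the set of $v\in V$ with $\{j:v\in c_j\}=J$, and $\gamma_J=|\Gamma_J|$. The support of $H\subseteq V$ is $S(H)=\{J:H\cap\Gamma_J\neq\emptyset\}$. A family of sets is intersecting if any two distinct members intersect; a maximal intersecting family on $S(G)$ is an intersecting family $\mathcal{F}\subseteq S(G)$ not properly contained in any intersecting family $\mathcal{F}'\subseteq S(G)$. -}

module Defs where

open import Data.Bool using (Bool; true; false; if_then_else_; _∧_; not)
open import Data.Bool.Properties using () renaming (_≟_ to _≟ᵇ_)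
open import Data.Nat using (ℕ; zero; suc; _+_; _∸_)
import Data.Nat as ℕ
open import Data.Fin using (Fin)
open import Data.Fin.Subset using (Subset; _∈_; _∩_; ∣_∣; Nonempty; _⊆_)
open import Data.Fin.Subset.Properties using (_∈?_; nonempty?)
open import Data.Vec using (Vec; []; _∷_; tabulate)
open import Data.Vec.Properties using (≡-dec)
open import Data.List using (List; []; _∷_; map; _++_; length; foldr)
open import Data.Nat.ListAction using (sum)
open import Data.Integer using (ℤ; +_; -1ℤ; _-_; _*_) renaming (_+_ to _+ℤ_; _^_ to _^ℤ_)
open import Data.Product using (Σ; _×_; ∃)
open import Relation.Nullary using (¬_)
open import Relation.Nullary.Decidable using (isYes)
open import Relation.Binary.PropositionalEquality using (_≡_; _≢_)

-- Vertices are elements of Fin n; the cliques c₁,…,c_m are given as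
-- c : Fin m → Subset n.  Index sets J ⊆ {1,…,m} are elements of Subset m.

module _ {m n : ℕ} (c : Fin m → Subset n) where

  pattern′ : Fin n → Subset m
  pattern′ v = tabulate (λ j → isYes (v ∈? c j))

  V : Subset n
  V = tabulate (λ v → isYes (nonempty? (pattern′ v)))

  Adj : Fin n → Fin n → Set
  Adj u v = u ≢ v × ∃ (λ j → u ∈ c j × v ∈ c j)

  IsCliqueOfU : Subset n → Set
  IsCliqueOfU K = K ⊆ V × (∀ u v → u ∈ K → v ∈ K → u ≢ v → Adj u v)

  Γ : Subset m → Subset n
  Γ J = tabulate (λ v → isYes (v ∈? V) ∧ isYes (≡-dec _≟ᵇ_ (pattern′ v) J))

  γ : Subset m → ℕ
  γ J = ∣ Γ J ∣

Family : ℕ → Set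
Family m = Subset m → Bool

_∈F_ : ∀ {m} → Subset m → Family m → Set
J ∈F F = F J ≡ true

_⊆F_ : ∀ {m} → Family m → Family m → Set
F ⊆F G = ∀ J → J ∈F F → J ∈F G

allSubsets : (m : ℕ) → List (Subset m)
allSubsets zero = [] ∷ []
allSubsets (suc m) = map (true ∷_) (allSubsets m) ++ map (false ∷_) (allSubsets m)

subseqs : ∀ {a} {A : Set a} → List A → List (List A)
subseqs [] = [] ∷ []
subseqs (x ∷ xs) = map (x ∷_) (subseqs xs) ++ subseqs xs

⋂F : ∀ {m} → List (Family m) → Family m
⋂F [] J = true
⋂F (F ∷ Fs) J = F J ∧ ⋂F Fs J

module _ {m n : ℕ} (c : Fin m → Subset n) where

  Supp : Subset n → Family m
  Supp H J = isYes (nonempty? (H ∩ Γ c J))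

  SG : Family m
  SG J = isYes (nonempty? (Γ c J))

  N : Family m → ℕ
  N F = sum (map (λ J → if F J then γ c J else 0) (allSubsets m))

  Intersecting : Family m → Set
  Intersecting F = ∀ J K → J ∈F F → K ∈F F → J ≢ K → Nonempty (J ∩ K)

  IntersectingOnSG : Family m → Set
  IntersectingOnSG F = F ⊆F SG × Intersecting F

  MaximalIntersecting : Family m → Set
  MaximalIntersecting F =
    IntersectingOnSG F ×
    (∀ F′ → IntersectingOnSG F′ → F ⊆F F′ → F′ ⊆F F)

  InMH : Subset n → Family m → Set
  InMH H F = MaximalIntersecting F × Supp H ⊆F F

  term : Subset n → List (Family m) → ℤ
  term H Js = (-1ℤ ^ℤ (length Js + 1)) * ((+ (2 ℕ.^ (N (⋂F Js) ∸ ∣ H ∣))) - + 1)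

  -- 1 + Σ_{∅ ≠ 𝓙 ⊆ 𝓜_H} term, where Ms lists 𝓜_H
  formula : Subset n → List (Family m) → ℤ
  formula H Ms = foldr (λ Js acc → nonemptyTerm Js +ℤ acc) (+ 1) (subseqs Ms)
    where
    nonemptyTerm : List (Family m) → ℤ
    nonemptyTerm [] = + 0
    nonemptyTerm Js@(_ ∷ _) = term H Js

-- A set K ⊇ H of vertices is a clique of U exactly when its support S(K) is intersecting, and
-- S(K) ⊇ S(H) extends to a maximal intersecting family on S(G). So the cliques containing H are the K
-- with H ⊆ K ⊆ ⋃Γ F for some F ∈ 𝓜_H, where ⋃Γ F = ⋃_{J ∈ F} Γ_J has N(F) vertices. As
-- ⋃Γ (⋂ 𝓙) = ⋂_{F ∈ 𝓙} ⋃Γ F, there are 2^{N(⋂𝓙) - |H|} sets K between H and every ⋃Γ F with F ∈ 𝓙,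
-- and inclusion–exclusion over the nonempty 𝓙 ⊆ 𝓜_H counts the union. Each term's -1 removes K = H,
-- which the leading 1 restores, since Σ_{𝓙 ≠ ∅} (-1)^{|𝓙|+1} = 1 once 𝓜_H ≠ ∅ (H itself is a clique).

module Submission where

open import Algebra.Bundles using (CommutativeMonoid)
open import Data.Bool using (Bool; true; false; T; _∧_; _∨_; if_then_else_)
import Data.Bool.Properties as Bool
open import Data.Bool.ListAction using (all; any)
open import Data.Fin using (Fin; zero; suc)
open import Data.Fin.Subset using (Subset; Nonempty; _⊆_; _∩_; ∣_∣)
open import Data.Fin.Subset.Properties
  using (anySubset?; nonempty?; _⊆?_; ∩-comm; drop-∷-⊆; p∩q⊆p; p∩q⊆q; x∈p∩q⁺; x∈p∩q⁻; p⊆q⇒∣p∣≤∣q∣)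
open import Data.Integer using (ℤ; +_; -_; _+_; _-_; _*_; _^_; 0ℤ; -1ℤ)
import Data.Integer.Properties as ℤ
open import Data.Integer.Tactic.RingSolver using (solve-∀)
open import Data.List using (List; []; _∷_; _++_; map; foldr; length; allFin; null)
import Data.List as List
import Data.List.Properties as List
open import Data.List.Membership.Propositional using (find)
open import Data.List.Relation.Unary.All using (All; []; _∷_)
import Data.List.Relation.Unary.All as All
import Data.List.Relation.Unary.All.Properties as All
open import Data.List.Relation.Unary.AllPairs using (AllPairs; []; _∷_)
open import Data.List.Relation.Unary.Any using (Any; here; there)
import Data.List.Relation.Unary.Any as Any
import Data.List.Relation.Unary.Any.Properties as Any
open import Data.List.Relation.Unary.Unique.Propositional using (Unique)
open import Data.Nat using (ℕ; zero; suc)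
import Data.Nat as ℕ
import Data.Nat.Properties as ℕ
open import Data.Product using (_×_; _,_; proj₁; proj₂; ∃)
open import Data.Product.Function.NonDependent.Propositional using (_×-⇔_)
open import Data.Sum using (_⊎_; inj₁; inj₂)
open import Data.Vec using ([]; _∷_; here; tabulate)
open import Data.Vec.Properties using (≡-dec)
import Data.Vec.Properties as Vec
open import Function using (id; _∘_; _$_; const)
open import Function.Bundles using (_⇔_; mk⇔; Equivalence)
import Function.Properties.Equivalence as ⇔
open import Relation.Binary.Definitions using (DecidableEquality)
open import Relation.Binary.PropositionalEquality using (_≡_; _≢_; _≗_; module ≡-Reasoning)
import Relation.Binary.PropositionalEquality as ≡
open import Relation.Nullary using (¬_; Dec; yes; no; does; contradiction; ¬?; _×-dec_; _→-dec_)
open import Relation.Nullary.Decidable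
  using (isYes; isYes≗does; does-⇔; dec-true; dec-false; T?; decidable-stable)
import Relation.Nullary.Decidable as Dec
open import Relation.Unary using (Decidable)

open import Defs

𝟙 : Bool → ℕ
𝟙 true  = 1
𝟙 false = 0

+𝟙-∧ : ∀ a b → + 𝟙 (a ∧ b) ≡ + 𝟙 a * + 𝟙 b
+𝟙-∧ true  b = ≡.sym (ℤ.*-identityˡ _)
+𝟙-∧ false b = ≡.refl

module _ {p} {P : Set p} where

  T-does⇔ : (P? : Dec P) → T (does P?) ⇔ P
  T-does⇔ (yes P-holds) = mk⇔ (const P-holds) (const _)
  T-does⇔ (no ¬P)       = mk⇔ (λ ()) ¬P

  does≡true⇔ : (P? : Dec P) → does P? ≡ true ⇔ P
  does≡true⇔ (yes P-holds) = mk⇔ (const P-holds) (const ≡.refl)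
  does≡true⇔ (no ¬P)       = mk⇔ (λ ()) (λ P-holds → contradiction P-holds ¬P)

  isYes≡true⇔ : (P? : Dec P) → isYes P? ≡ true ⇔ P
  isYes≡true⇔ (yes P-holds) = mk⇔ (const P-holds) (const ≡.refl)
  isYes≡true⇔ (no ¬P)       = mk⇔ (λ ()) (λ P-holds → contradiction P-holds ¬P)

∧≡true⇔ : ∀ {a b} → a ∧ b ≡ true ⇔ (a ≡ true × b ≡ true)
∧≡true⇔ {true}  = mk⇔ (≡.refl ,_) proj₂
∧≡true⇔ {false} = mk⇔ (λ ()) (λ ())

∨≡true⇒ : ∀ {a b} → a ∨ b ≡ true → a ≡ true ⊎ b ≡ true
∨≡true⇒ {true}  _ = inj₁ ≡.refl
∨≡true⇒ {false} b≡true = inj₂ b≡true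

All⇒all : ∀ {a} {A : Set a} {p : A → Bool} {xs} → All (T ∘ p) xs → T (all p xs)
All⇒all []         = _
All⇒all (px ∷ pxs) = Equivalence.from Bool.T-∧ (px , All⇒all pxs)

all-true : ∀ {a} {A : Set a} (xs : List A) → all (const true) xs ≡ true
all-true []       = ≡.refl
all-true (_ ∷ xs) = all-true xs

-- Sums over lists

module SumProperties {c ℓ} (M : CommutativeMonoid c ℓ) where
  open CommutativeMonoid M
  open import Algebra.Properties.CommutativeSemigroup commutativeSemigroup using (interchange)
  open import Relation.Binary.Reasoning.Setoid setoid

  ∑ : ∀ {a} {A : Set a} → List A → (A → Carrier) → Carrier
  ∑ xs f = foldr _∙_ ε (map f xs)

  module _ {a} {A : Set a} where

    ∑-congᴬ : ∀ {f g : A → Carrier} {xs} → All (λ x → f x ≈ g x) xs → ∑ xs f ≈ ∑ xs g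
    ∑-congᴬ []         = refl
    ∑-congᴬ (fx≈gx ∷ p) = ∙-cong fx≈gx (∑-congᴬ p)

    ∑-cong : ∀ {f g : A → Carrier} → (∀ x → f x ≈ g x) → ∀ xs → ∑ xs f ≈ ∑ xs g
    ∑-cong f≈g []       = refl
    ∑-cong f≈g (x ∷ xs) = ∙-cong (f≈g x) (∑-cong f≈g xs)

    ∑-zero : ∀ (xs : List A) → ∑ xs (λ _ → ε) ≈ ε
    ∑-zero []       = refl
    ∑-zero (x ∷ xs) = trans (identityˡ _) (∑-zero xs)

    ∑-++ : ∀ xs ys (f : A → Carrier) → ∑ (xs ++ ys) f ≈ ∑ xs f ∙ ∑ ys f
    ∑-++ []       ys f = sym (identityˡ _)
    ∑-++ (x ∷ xs) ys f = begin
      f x ∙ ∑ (xs ++ ys) f       ≈⟨ ∙-congˡ (∑-++ xs ys f) ⟩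
      f x ∙ (∑ xs f ∙ ∑ ys f)    ≈⟨ assoc _ _ _ ⟨
      f x ∙ ∑ xs f ∙ ∑ ys f      ∎

    ∑-distrib : ∀ xs (f g : A → Carrier) → ∑ xs (λ x → f x ∙ g x) ≈ ∑ xs f ∙ ∑ xs g
    ∑-distrib []       f g = sym (identityˡ ε)
    ∑-distrib (x ∷ xs) f g = begin
      (f x ∙ g x) ∙ ∑ xs (λ x → f x ∙ g x)  ≈⟨ ∙-congˡ (∑-distrib xs f g) ⟩
      (f x ∙ g x) ∙ (∑ xs f ∙ ∑ xs g)       ≈⟨ interchange _ _ _ _ ⟩
      (f x ∙ ∑ xs f) ∙ (g x ∙ ∑ xs g)       ∎

    foldr≈∑ : ∀ (h : A → Carrier → Carrier) (g : A → Carrier) →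
              (∀ x y → h x y ≈ g x ∙ y) → ∀ e xs → foldr h e xs ≈ ∑ xs g ∙ e
    foldr≈∑ h g h≈g e []       = sym (identityˡ e)
    foldr≈∑ h g h≈g e (x ∷ xs) = begin
      h x (foldr h e xs)     ≈⟨ h≈g x _ ⟩
      g x ∙ foldr h e xs     ≈⟨ ∙-congˡ (foldr≈∑ h g h≈g e xs) ⟩
      g x ∙ (∑ xs g ∙ e)     ≈⟨ assoc _ _ _ ⟨
      g x ∙ ∑ xs g ∙ e       ∎

  module _ {a b} {A : Set a} {B : Set b} where

    ∑-map : ∀ (g : A → B) xs (f : B → Carrier) → ∑ (map g xs) f ≡ ∑ xs (f ∘ g)
    ∑-map g xs f = ≡.cong (foldr _∙_ ε) (≡.sym (List.map-∘ xs))

    ∑-comm : ∀ xs ys (f : A → B → Carrier) →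
             ∑ xs (λ x → ∑ ys (f x)) ≈ ∑ ys (λ y → ∑ xs (λ x → f x y))
    ∑-comm []       ys f = sym (∑-zero ys)
    ∑-comm (x ∷ xs) ys f = begin
      ∑ ys (f x) ∙ ∑ xs (λ x → ∑ ys (f x))              ≈⟨ ∙-congˡ (∑-comm xs ys f) ⟩
      ∑ ys (f x) ∙ ∑ ys (λ y → ∑ xs (λ x → f x y))      ≈⟨ ∑-distrib ys (f x) _ ⟨
      ∑ ys (λ y → f x y ∙ ∑ xs (λ x → f x y))           ∎

  ∑-allSubsets-suc : ∀ n (f : Subset (suc n) → Carrier) →
    ∑ (allSubsets (suc n)) f ≈ ∑ (allSubsets n) (f ∘ (true ∷_)) ∙ ∑ (allSubsets n) (f ∘ (false ∷_))
  ∑-allSubsets-suc n f = begin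
    ∑ (map (true ∷_) S ++ map (false ∷_) S) f          ≈⟨ ∑-++ (map (true ∷_) S) _ f ⟩
    ∑ (map (true ∷_) S) f ∙ ∑ (map (false ∷_) S) f     ≡⟨ ≡.cong₂ _∙_ (∑-map _ S f) (∑-map _ S f) ⟩
    ∑ S (f ∘ (true ∷_)) ∙ ∑ S (f ∘ (false ∷_))         ∎
    where S = allSubsets n

module _ {c₁ ℓ₁ c₂ ℓ₂} (M₁ : CommutativeMonoid c₁ ℓ₁) (M₂ : CommutativeMonoid c₂ ℓ₂) where
  private
    module M₁ = CommutativeMonoid M₁
    module M₂ = CommutativeMonoid M₂
    module ∑₁ = SumProperties M₁
    module ∑₂ = SumProperties M₂
  open import Relation.Binary.Reasoning.Setoid M₂.setoid

  ∑-homo : (h : M₁.Carrier → M₂.Carrier) → h M₁.ε M₂.≈ M₂.ε →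
           (∀ x y → h (x M₁.∙ y) M₂.≈ h x M₂.∙ h y) →
           ∀ {a} {A : Set a} (xs : List A) f → h (∑₁.∑ xs f) M₂.≈ ∑₂.∑ xs (h ∘ f)
  ∑-homo h h-ε h-∙ []       f = h-ε
  ∑-homo h h-ε h-∙ (x ∷ xs) f = begin
    h (f x M₁.∙ ∑₁.∑ xs f)       ≈⟨ h-∙ _ _ ⟩
    h (f x) M₂.∙ h (∑₁.∑ xs f)   ≈⟨ M₂.∙-congˡ (∑-homo h h-ε h-∙ xs f) ⟩
    h (f x) M₂.∙ ∑₂.∑ xs (h ∘ f) ∎

open ≡-Reasoning

module ℕ∑ = SumProperties ℕ.+-0-commutativeMonoid
module ℤ∑ = SumProperties ℤ.+-0-commutativeMonoid
open ℕ∑ using () renaming (∑ to ∑ℕ)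
open ℤ∑ using (∑)

module _ {a} {A : Set a} where

  ∑-*ˡ : ∀ k (xs : List A) f → k * ∑ xs f ≡ ∑ xs (λ x → k * f x)
  ∑-*ˡ k = ∑-homo ℤ.+-0-commutativeMonoid ℤ.+-0-commutativeMonoid (k *_)
             (ℤ.*-zeroʳ k) (ℤ.*-distribˡ-+ k)

  ∑-neg : ∀ (xs : List A) f → - ∑ xs f ≡ ∑ xs (λ x → - f x)
  ∑-neg = ∑-homo ℤ.+-0-commutativeMonoid ℤ.+-0-commutativeMonoid -_ ≡.refl ℤ.neg-distrib-+

  ∑-- : ∀ (xs : List A) f g → ∑ xs (λ x → f x - g x) ≡ ∑ xs f - ∑ xs g
  ∑-- xs f g = ≡.trans (ℤ∑.∑-distrib xs f (λ x → - g x)) (≡.cong (λ y → ∑ xs f + y) (≡.sym (∑-neg xs g)))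

  +-∑ℕ : ∀ (xs : List A) f → + ∑ℕ xs f ≡ ∑ xs (λ x → + f x)
  +-∑ℕ = ∑-homo ℕ.+-0-commutativeMonoid ℤ.+-0-commutativeMonoid +_ ≡.refl ℤ.pos-+

-- Counting subsets of Fin n

-- `does` rather than `isYes`, so that `_⊆ᵇ_` computes on `_∷_`.
_⊆ᵇ_ : ∀ {n} → Subset n → Subset n → Bool
K ⊆ᵇ W = does (K ⊆? W)

⊆ᵇ-∩ : ∀ {n} (K W W′ : Subset n) → K ⊆ᵇ (W ∩ W′) ≡ K ⊆ᵇ W ∧ K ⊆ᵇ W′
⊆ᵇ-∩ K W W′ = does-⇔ ⊆-∩⇔ (K ⊆? W ∩ W′) ((K ⊆? W) ×-dec (K ⊆? W′))
  where
  ⊆-∩⇔ : K ⊆ W ∩ W′ ⇔ (K ⊆ W × K ⊆ W′)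
  ⊆-∩⇔ = mk⇔ (λ K⊆W∩W′ → (λ {x} x∈K → p∩q⊆p W W′ (K⊆W∩W′ x∈K)) , (λ {x} x∈K → p∩q⊆q W W′ (K⊆W∩W′ x∈K)))
              (λ (K⊆W , K⊆W′) {x} x∈K → x∈p∩q⁺ (K⊆W x∈K , K⊆W′ x∈K))

∑-𝟙-∧-false : ∀ {a} {A : Set a} (f : A → Bool) xs → ∑ℕ xs (λ x → 𝟙 (f x ∧ false)) ≡ 0
∑-𝟙-∧-false f xs = ≡.trans (ℕ∑.∑-cong (λ x → ≡.cong 𝟙 (Bool.∧-zeroʳ (f x))) xs) (ℕ∑.∑-zero xs)

count-between : ∀ {n} (H W : Subset n) → H ⊆ W →
  ∑ℕ (allSubsets n) (λ K → 𝟙 (H ⊆ᵇ K ∧ K ⊆ᵇ W)) ≡ 2 ℕ.^ (∣ W ∣ ℕ.∸ ∣ H ∣)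
count-between []          []          _   = ≡.refl
count-between (true ∷ H)  (false ∷ W) H⊆W with () ← H⊆W here
count-between {suc n} (true ∷ H) (true ∷ W) H⊆W = ≡.trans (ℕ∑.∑-allSubsets-suc n _) $ begin
  ∑ℕ S (λ K → 𝟙 (H ⊆ᵇ K ∧ K ⊆ᵇ W)) ℕ.+ ∑ℕ S (λ _ → 0)
    ≡⟨ ≡.cong₂ ℕ._+_ (count-between H W (drop-∷-⊆ H⊆W)) (ℕ∑.∑-zero S) ⟩
  2 ℕ.^ (∣ W ∣ ℕ.∸ ∣ H ∣) ℕ.+ 0
    ≡⟨ ℕ.+-identityʳ _ ⟩
  2 ℕ.^ (∣ W ∣ ℕ.∸ ∣ H ∣)
    ∎
  where S = allSubsets n
count-between {suc n} (false ∷ H) (true ∷ W) H⊆W = ≡.trans (ℕ∑.∑-allSubsets-suc n _) $ begin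
  ∑ℕ S (λ K → 𝟙 (H ⊆ᵇ K ∧ K ⊆ᵇ W)) ℕ.+ ∑ℕ S (λ K → 𝟙 (H ⊆ᵇ K ∧ K ⊆ᵇ W))
    ≡⟨ ≡.cong₂ ℕ._+_ IH (≡.trans IH (≡.sym (ℕ.+-identityʳ _))) ⟩
  2 ℕ.* 2 ℕ.^ (∣ W ∣ ℕ.∸ ∣ H ∣)
    ≡⟨ ≡.cong (2 ℕ.^_) (ℕ.+-∸-assoc 1 (p⊆q⇒∣p∣≤∣q∣ (drop-∷-⊆ H⊆W))) ⟨
  2 ℕ.^ (suc ∣ W ∣ ℕ.∸ ∣ H ∣)
    ∎
  where
  S = allSubsets n
  IH = count-between H W (drop-∷-⊆ H⊆W)
count-between {suc n} (false ∷ H) (false ∷ W) H⊆W = ≡.trans (ℕ∑.∑-allSubsets-suc n _) $ begin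
  ∑ℕ S (λ K → 𝟙 (H ⊆ᵇ K ∧ false)) ℕ.+ ∑ℕ S (λ K → 𝟙 (H ⊆ᵇ K ∧ K ⊆ᵇ W))
    ≡⟨ ≡.cong (ℕ._+ ∑ℕ S (λ K → 𝟙 (H ⊆ᵇ K ∧ K ⊆ᵇ W))) (∑-𝟙-∧-false (H ⊆ᵇ_) S) ⟩
  ∑ℕ S (λ K → 𝟙 (H ⊆ᵇ K ∧ K ⊆ᵇ W))
    ≡⟨ count-between H W (drop-∷-⊆ H⊆W) ⟩
  2 ℕ.^ (∣ W ∣ ℕ.∸ ∣ H ∣)
    ∎
  where S = allSubsets n

_≟ˢ_ : ∀ {n} → DecidableEquality (Subset n)
_≟ˢ_ = ≡-dec Bool._≟_

∑-select : ∀ {n} (P : Subset n → Bool) (X : Subset n) →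
  ∑ℕ (allSubsets n) (λ K → 𝟙 (P K ∧ does (X ≟ˢ K))) ≡ 𝟙 (P X)
∑-select P [] = ≡.trans (ℕ.+-identityʳ _) (≡.cong 𝟙 (Bool.∧-identityʳ (P [])))
∑-select {suc n} P (true ∷ X) = ≡.trans (ℕ∑.∑-allSubsets-suc n _) $ begin
  ∑ℕ S (λ K → 𝟙 (P (true ∷ K) ∧ does (X ≟ˢ K))) ℕ.+ ∑ℕ S (λ K → 𝟙 (P (false ∷ K) ∧ false))
    ≡⟨ ≡.cong₂ ℕ._+_ (∑-select (P ∘ (true ∷_)) X) (∑-𝟙-∧-false (P ∘ (false ∷_)) S) ⟩
  𝟙 (P (true ∷ X)) ℕ.+ 0
    ≡⟨ ℕ.+-identityʳ _ ⟩
  𝟙 (P (true ∷ X))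
    ∎
  where S = allSubsets n
∑-select {suc n} P (false ∷ X) = ≡.trans (ℕ∑.∑-allSubsets-suc n _) $ begin
  ∑ℕ S (λ K → 𝟙 (P (true ∷ K) ∧ false)) ℕ.+ ∑ℕ S (λ K → 𝟙 (P (false ∷ K) ∧ does (X ≟ˢ K)))
    ≡⟨ ≡.cong₂ ℕ._+_ (∑-𝟙-∧-false (P ∘ (true ∷_)) S) (∑-select (P ∘ (false ∷_)) X) ⟩
  𝟙 (P (false ∷ X))
    ∎
  where S = allSubsets n

∣∷∣ : ∀ {n} b (p : Subset n) → ∣ b ∷ p ∣ ≡ 𝟙 b ℕ.+ ∣ p ∣
∣∷∣ true  p = ≡.refl
∣∷∣ false p = ≡.refl

∣tabulate∣ : ∀ {n} (f : Fin n → Bool) → ∣ tabulate f ∣ ≡ ∑ℕ (allFin n) (𝟙 ∘ f)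
∣tabulate∣ {zero}  f = ≡.refl
∣tabulate∣ {suc n} f = begin
  ∣ f zero ∷ tabulate (f ∘ suc) ∣
    ≡⟨ ∣∷∣ (f zero) (tabulate (f ∘ suc)) ⟩
  𝟙 (f zero) ℕ.+ ∣ tabulate (f ∘ suc) ∣
    ≡⟨ ≡.cong (𝟙 (f zero) ℕ.+_) (∣tabulate∣ (f ∘ suc)) ⟩
  𝟙 (f zero) ℕ.+ ∑ℕ (allFin n) (𝟙 ∘ f ∘ suc)
    ≡⟨ ≡.cong (𝟙 (f zero) ℕ.+_) (ℕ∑.∑-map suc (allFin n) (𝟙 ∘ f)) ⟨
  𝟙 (f zero) ℕ.+ ∑ℕ (map suc (allFin n)) (𝟙 ∘ f)
    ≡⟨ ≡.cong (λ vs → 𝟙 (f zero) ℕ.+ ∑ℕ vs (𝟙 ∘ f)) (List.map-tabulate id suc) ⟩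
  𝟙 (f zero) ℕ.+ ∑ℕ (List.tabulate suc) (𝟙 ∘ f)
    ∎

tabulate-∧ : ∀ {n} (f g : Fin n → Bool) → tabulate (λ v → f v ∧ g v) ≡ tabulate f ∩ tabulate g
tabulate-∧ {zero}  f g = ≡.refl
tabulate-∧ {suc n} f g = ≡.cong (f zero ∧ g zero ∷_) (tabulate-∧ (f ∘ suc) (g ∘ suc))

module _ {n : ℕ} where
  open import Data.Fin.Subset using (_∈_)

  ∈-tabulate⇔ : ∀ {f : Fin n → Bool} {v} → v ∈ tabulate f ⇔ f v ≡ true
  ∈-tabulate⇔ {f} {v} = mk⇔
    (λ v∈ → ≡.trans (≡.sym (Vec.lookup∘tabulate f v)) (Vec.[]=⇒lookup v∈))
    (λ fv → Vec.lookup⇒[]= v _ (≡.trans (Vec.lookup∘tabulate f v) fv))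

∈-allSubsets : ∀ {n} (X : Subset n) → Any (X ≡_) (allSubsets n)
∈-allSubsets []          = here ≡.refl
∈-allSubsets (true ∷ X)  = Any.++⁺ˡ (Any.map⁺ (Any.map (≡.cong (true ∷_)) (∈-allSubsets X)))
∈-allSubsets (false ∷ X) = Any.++⁺ʳ _ (Any.map⁺ (Any.map (≡.cong (false ∷_)) (∈-allSubsets X)))

∀-subset? : ∀ {n p} {P : Subset n → Set p} → Decidable P → Dec (∀ K → P K)
∀-subset? {P = P} P? = Dec.map (mk⇔ ¬∃¬⇒∀ ∀⇒¬∃¬) (¬? (anySubset? (¬? ∘ P?)))
  where
  ¬∃¬⇒∀ : ¬ (∃ λ K → ¬ P K) → ∀ K → P K
  ¬∃¬⇒∀ ¬∃¬P K = decidable-stable (P? K) (λ ¬PK → ¬∃¬P (K , ¬PK))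
  ∀⇒¬∃¬ : (∀ K → P K) → ¬ (∃ λ K → ¬ P K)
  ∀⇒¬∃¬ ∀P (K , ¬PK) = ¬PK (∀P K)

module _ {n : ℕ} where
  open import Data.List.Membership.DecPropositional (_≟ˢ_ {n}) using (_∈_; _∈?_)

  ∑-occurrences : ∀ {L : List (Subset n)} → Unique L → ∀ K →
                  ∑ℕ L (λ y → 𝟙 (does (y ≟ˢ K))) ≡ 𝟙 (does (K ∈? L))
  ∑-occurrences []                  K = ≡.refl
  ∑-occurrences {y ∷ L} (y∉L ∷ uniq) K with y ≟ˢ K
  ... | yes ≡.refl rewrite dec-true (y ≟ˢ y) ≡.refl
    = ≡.cong suc (≡.trans (∑-occurrences uniq y) (≡.cong 𝟙 (dec-false (y ∈? L) (λ y∈L → All.lookup y∉L y∈L ≡.refl))))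
  ... | no y≢K rewrite dec-false (K ≟ˢ y) (y≢K ∘ ≡.sym) = ∑-occurrences uniq K

  length-unique : ∀ {L : List (Subset n)} → Unique L → (Q : Subset n → Bool) →
                  (∀ K → K ∈ L ⇔ T (Q K)) → length L ≡ ∑ℕ (allSubsets n) (𝟙 ∘ Q)
  length-unique {L} uniq Q L⇔Q = ≡.sym $ begin
    ∑ℕ S (𝟙 ∘ Q)
      ≡⟨ ℕ∑.∑-cong (λ K → ≡.cong 𝟙 (does-⇔ (L⇔Q K) (K ∈? L) (T? (Q K)))) S ⟨
    ∑ℕ S (λ K → 𝟙 (does (K ∈? L)))
      ≡⟨ ℕ∑.∑-cong (λ K → ∑-occurrences uniq K) S ⟨
    ∑ℕ S (λ K → ∑ℕ L (λ y → 𝟙 (does (y ≟ˢ K))))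
      ≡⟨ ℕ∑.∑-comm S L _ ⟩
    ∑ℕ L (λ y → ∑ℕ S (λ K → 𝟙 (does (y ≟ˢ K))))
      ≡⟨ ℕ∑.∑-cong (∑-select (const true)) L ⟩
    ∑ℕ L (const 1)
      ≡⟨ count-ones L ⟩
    length L
      ∎
    where
    S = allSubsets n
    count-ones : (xs : List (Subset n)) → ∑ℕ xs (const 1) ≡ length xs
    count-ones []       = ≡.refl
    count-ones (_ ∷ xs) = ≡.cong suc (count-ones xs)

-- Inclusion–exclusion

module _ {a} {A : Set a} where

  ieTerm : (A → Bool) → List A → ℤ
  ieTerm p []         = 0ℤ
  ieTerm p xs@(_ ∷ _) = -1ℤ ^ (length xs ℕ.+ 1) * + 𝟙 (all p xs)

  ∑-subseqs-null : (xs : List A) → ∑ (subseqs xs) (λ ys → + 𝟙 (null ys)) ≡ + 1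
  ∑-subseqs-null []       = ≡.refl
  ∑-subseqs-null (x ∷ xs) = begin
    ∑ (map (x ∷_) S ++ S) 𝟙-null
      ≡⟨ ℤ∑.∑-++ (map (x ∷_) S) S 𝟙-null ⟩
    ∑ (map (x ∷_) S) 𝟙-null + ∑ S 𝟙-null
      ≡⟨ ≡.cong₂ _+_ (≡.trans (ℤ∑.∑-map (x ∷_) S 𝟙-null) (ℤ∑.∑-zero S)) (∑-subseqs-null xs) ⟩
    0ℤ + + 1
      ∎
    where
    S = subseqs xs
    𝟙-null : List A → ℤ
    𝟙-null ys = + 𝟙 (null ys)

  inclusion-exclusion : ∀ (p : A → Bool) xs → ∑ (subseqs xs) (ieTerm p) ≡ + 𝟙 (any p xs)
  inclusion-exclusion p []       = ≡.refl
  inclusion-exclusion p (x ∷ xs) = begin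
    ∑ (map (x ∷_) S ++ S) (ieTerm p)
      ≡⟨ ℤ∑.∑-++ (map (x ∷_) S) S (ieTerm p) ⟩
    ∑ (map (x ∷_) S) (ieTerm p) + ∑ S (ieTerm p)
      ≡⟨ ≡.cong₂ _+_ (ℤ∑.∑-map (x ∷_) S (ieTerm p)) (inclusion-exclusion p xs) ⟩
    ∑ S (ieTerm p ∘ (x ∷_)) + + 𝟙 (any p xs)
      ≡⟨ extend (p x) ≡.refl ⟩
    + 𝟙 (p x ∨ any p xs)
      ∎
    where
    S = subseqs xs
    extend : ∀ b → p x ≡ b → ∑ S (ieTerm p ∘ (x ∷_)) + + 𝟙 (any p xs) ≡ + 𝟙 (b ∨ any p xs)
    extend false px≡false = begin
      ∑ S (ieTerm p ∘ (x ∷_)) + + 𝟙 (any p xs)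
        ≡⟨ ≡.cong (_+ + 𝟙 (any p xs)) (≡.trans (ℤ∑.∑-cong vanishes S) (ℤ∑.∑-zero S)) ⟩
      0ℤ + + 𝟙 (any p xs)
        ≡⟨ ℤ.+-identityˡ _ ⟩
      + 𝟙 (any p xs)
        ∎
      where
      vanishes : ∀ ys → ieTerm p (x ∷ ys) ≡ 0ℤ
      vanishes ys rewrite px≡false = ℤ.*-zeroʳ (-1ℤ ^ (length (x ∷ ys) ℕ.+ 1))
    extend true px≡true = begin
      ∑ S (ieTerm p ∘ (x ∷_)) + + 𝟙 (any p xs)
        ≡⟨ ≡.cong (_+ + 𝟙 (any p xs)) (ℤ∑.∑-cong alternates S) ⟩
      ∑ S (λ ys → + 𝟙 (null ys) - ieTerm p ys) + + 𝟙 (any p xs)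
        ≡⟨ ≡.cong (_+ + 𝟙 (any p xs)) (∑-- S _ (ieTerm p)) ⟩
      ∑ S (λ ys → + 𝟙 (null ys)) - ∑ S (ieTerm p) + + 𝟙 (any p xs)
        ≡⟨ ≡.cong₂ (λ u v → u - v + + 𝟙 (any p xs)) (∑-subseqs-null xs) (inclusion-exclusion p xs) ⟩
      + 1 - + 𝟙 (any p xs) + + 𝟙 (any p xs)
        ≡⟨ cancel (+ 𝟙 (any p xs)) ⟩
      + 1
        ∎
      where
      cancel : ∀ u → + 1 - u + u ≡ + 1
      cancel = solve-∀
      sign-flip : ∀ s b → (-1ℤ * s) * b ≡ + 0 - s * b
      sign-flip = solve-∀
      alternates : ∀ ys → ieTerm p (x ∷ ys) ≡ + 𝟙 (null ys) - ieTerm p ys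
      alternates []       rewrite px≡true = ≡.refl
      alternates (y ∷ ys) rewrite px≡true = sign-flip (-1ℤ ^ (length (y ∷ ys) ℕ.+ 1)) (+ 𝟙 (all p (y ∷ ys)))

All-subseqs : ∀ {a p} {A : Set a} {P : A → Set p} {xs} → All P xs → All (All P) (subseqs xs)
All-subseqs []         = [] ∷ []
All-subseqs (px ∷ pxs) = All.++⁺ (All.map⁺ (All.map (px ∷_) (All-subseqs pxs))) (All-subseqs pxs)

-- Supports, cliques and maximal intersecting families

module _ {m n : ℕ} (c : Fin m → Subset n) where
  open import Data.Fin.Subset using (_∈_)
  open import Data.Fin.Subset.Properties using (_∈?_)

  ⋃Γ : Family m → Subset n
  ⋃Γ F = tabulate (λ v → isYes (v ∈? V c) ∧ F (pattern′ c v))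

  ∈pattern⇔ : ∀ {v j} → j ∈ pattern′ c v ⇔ v ∈ c j
  ∈pattern⇔ {v} {j} = ⇔.trans ∈-tabulate⇔ (isYes≡true⇔ (v ∈? c j))

  ∈V⇔ : ∀ {v} → v ∈ V c ⇔ Nonempty (pattern′ c v)
  ∈V⇔ = ⇔.trans ∈-tabulate⇔ (isYes≡true⇔ (nonempty? _))

  ∈Γ⇔ : ∀ {v J} → v ∈ Γ c J ⇔ (v ∈ V c × pattern′ c v ≡ J)
  ∈Γ⇔ {v} {J} = ⇔.trans ∈-tabulate⇔
    (⇔.trans ∧≡true⇔ (isYes≡true⇔ (v ∈? V c) ×-⇔ isYes≡true⇔ (≡-dec Bool._≟_ (pattern′ c v) J)))

  ∈⋃Γ⇔ : ∀ F {v} → v ∈ ⋃Γ F ⇔ (v ∈ V c × pattern′ c v ∈F F)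
  ∈⋃Γ⇔ F {v} = ⇔.trans ∈-tabulate⇔ (⇔.trans ∧≡true⇔ (isYes≡true⇔ (v ∈? V c) ×-⇔ ⇔.refl))

  ∈Supp⇔ : ∀ K {J} → J ∈F Supp c K ⇔ Nonempty (K ∩ Γ c J)
  ∈Supp⇔ K = isYes≡true⇔ (nonempty? _)

  ∈SG⇔ : ∀ {J} → J ∈F SG c ⇔ Nonempty (Γ c J)
  ∈SG⇔ = isYes≡true⇔ (nonempty? _)

  ⋃Γ-cong : ∀ {F G} → F ≗ G → ⋃Γ F ≡ ⋃Γ G
  ⋃Γ-cong F≗G = Vec.tabulate-cong (λ v → ≡.cong (isYes (v ∈? V c) ∧_) (F≗G (pattern′ c v)))

  ⋃Γ-mono : ∀ {F G} → F ⊆F G → ⋃Γ F ⊆ ⋃Γ G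
  ⋃Γ-mono {F} {G} F⊆G v∈⋃ΓF with v∈V , pv∈F ← Equivalence.to (∈⋃Γ⇔ F) v∈⋃ΓF =
    Equivalence.from (∈⋃Γ⇔ G) (v∈V , F⊆G _ pv∈F)

  ⋃Γ-∧ : ∀ F G → ⋃Γ (λ J → F J ∧ G J) ≡ ⋃Γ F ∩ ⋃Γ G
  ⋃Γ-∧ F G = ≡.trans (Vec.tabulate-cong (λ v → ∧-distribˡ-∧ (isYes (v ∈? V c)) _ _)) (tabulate-∧ _ _)
    where
    ∧-distribˡ-∧ : ∀ a b d → a ∧ (b ∧ d) ≡ (a ∧ b) ∧ (a ∧ d)
    ∧-distribˡ-∧ true  b d = ≡.refl
    ∧-distribˡ-∧ false b d = ≡.refl

  Supp-witness : ∀ {K J} → J ∈F Supp c K → ∃ λ v → v ∈ K × v ∈ V c × pattern′ c v ≡ J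
  Supp-witness {K} {J} J∈SuppK with v , v∈K∩Γ ← Equivalence.to (∈Supp⇔ K) J∈SuppK
    with v∈K , v∈Γ ← x∈p∩q⁻ K (Γ c J) v∈K∩Γ = v , v∈K , Equivalence.to ∈Γ⇔ v∈Γ

  pattern∈Supp : ∀ {K v} → v ∈ K → v ∈ V c → pattern′ c v ∈F Supp c K
  pattern∈Supp {K} {v} v∈K v∈V =
    Equivalence.from (∈Supp⇔ K) (v , x∈p∩q⁺ (v∈K , Equivalence.from ∈Γ⇔ (v∈V , ≡.refl)))

  ⊆-⋃Γ-Supp : ∀ {K} → K ⊆ V c → K ⊆ ⋃Γ (Supp c K)
  ⊆-⋃Γ-Supp {K} K⊆V v∈K = Equivalence.from (∈⋃Γ⇔ (Supp c K)) (K⊆V v∈K , pattern∈Supp v∈K (K⊆V v∈K))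

  Supp-mono : ∀ {H K} → H ⊆ K → Supp c H ⊆F Supp c K
  Supp-mono H⊆K J J∈SuppH with v , v∈H , v∈V , ≡.refl ← Supp-witness J∈SuppH = pattern∈Supp (H⊆K v∈H) v∈V

  Supp⊆SG : ∀ K → Supp c K ⊆F SG c
  Supp⊆SG K J J∈SuppK with v , _ , v∈V , ≡.refl ← Supp-witness J∈SuppK =
    Equivalence.from ∈SG⇔ (v , Equivalence.from ∈Γ⇔ (v∈V , ≡.refl))

  shared-clique : ∀ {u w j} → j ∈ pattern′ c u → j ∈ pattern′ c w → ∃ λ j → u ∈ c j × w ∈ c j
  shared-clique j∈pu j∈pw = _ , Equivalence.to ∈pattern⇔ j∈pu , Equivalence.to ∈pattern⇔ j∈pw

  Supp-intersecting : ∀ {K} → IsCliqueOfU c K → Intersecting c (Supp c K)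
  Supp-intersecting (_ , adjacent) J J′ J∈SuppK J′∈SuppK J≢J′
    with u , u∈K , _ , ≡.refl ← Supp-witness J∈SuppK
       | w , w∈K , _ , ≡.refl ← Supp-witness J′∈SuppK
    with _ , j , u∈cj , w∈cj ← adjacent u w u∈K w∈K (λ { ≡.refl → J≢J′ ≡.refl }) =
    j , x∈p∩q⁺ (Equivalence.from ∈pattern⇔ u∈cj , Equivalence.from ∈pattern⇔ w∈cj)

  ⊆⋃Γ⇒clique : ∀ {F K} → Intersecting c F → K ⊆ ⋃Γ F → IsCliqueOfU c K
  ⊆⋃Γ⇒clique {F} {K} F-intersecting K⊆⋃ΓF = K⊆V , adjacent
    where
    K⊆V : K ⊆ V c
    K⊆V = proj₁ ∘ Equivalence.to (∈⋃Γ⇔ F) ∘ K⊆⋃ΓF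

    adjacent : ∀ u w → u ∈ K → w ∈ K → u ≢ w → Adj c u w
    adjacent u w u∈K w∈K u≢w with pattern′ c u ≟ˢ pattern′ c w
    ... | yes pu≡pw with j , j∈pu ← Equivalence.to ∈V⇔ (K⊆V u∈K) =
      u≢w , shared-clique j∈pu (≡.subst (j ∈_) pu≡pw j∈pu)
    ... | no pu≢pw with j , j∈pu∩pw ← F-intersecting _ _ (proj₂ (Equivalence.to (∈⋃Γ⇔ F) (K⊆⋃ΓF u∈K)))
                                              (proj₂ (Equivalence.to (∈⋃Γ⇔ F) (K⊆⋃ΓF w∈K))) pu≢pw =
      u≢w , shared-clique (proj₁ (x∈p∩q⁻ _ _ j∈pu∩pw)) (proj₂ (x∈p∩q⁻ _ _ j∈pu∩pw))

  Compatible : Family m → Subset m → Set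
  Compatible F J = J ∈F SG c × (∀ K → K ∈F F → J ≢ K → Nonempty (J ∩ K))

  compatible? : ∀ F J → Dec (Compatible F J)
  compatible? F J = (SG c J Bool.≟ true) ×-dec ∀-subset? λ K →
    (F K Bool.≟ true) →-dec (¬? (J ≟ˢ K) →-dec nonempty? (J ∩ K))

  insertIfCompatible : Family m → Subset m → Family m
  insertIfCompatible F J K = F K ∨ (does (J ≟ˢ K) ∧ does (compatible? F J))

  insert-⊇ : ∀ F J → F ⊆F insertIfCompatible F J
  insert-⊇ F J K K∈F rewrite K∈F = ≡.refl

  insert-cases : ∀ F J K → K ∈F insertIfCompatible F J → K ∈F F ⊎ (J ≡ K × Compatible F J)
  insert-cases F J K K∈F′ with ∨≡true⇒ {F K} K∈F′
  ... | inj₁ K∈F = inj₁ K∈F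
  ... | inj₂ added with J≡K , compatible ← Equivalence.to ∧≡true⇔ added =
    inj₂ (Equivalence.to (does≡true⇔ (J ≟ˢ K)) J≡K , Equivalence.to (does≡true⇔ (compatible? F J)) compatible)

  insert-intersectingOnSG : ∀ {F} J → IntersectingOnSG c F → IntersectingOnSG c (insertIfCompatible F J)
  insert-intersectingOnSG {F} J (F⊆SG , F-intersecting) = ⊆SG , intersecting
    where
    ⊆SG : insertIfCompatible F J ⊆F SG c
    ⊆SG K K∈F′ with insert-cases F J K K∈F′
    ... | inj₁ K∈F                   = F⊆SG K K∈F
    ... | inj₂ (≡.refl , J∈SG , _)   = J∈SG

    intersecting : Intersecting c (insertIfCompatible F J)
    intersecting K K′ K∈F′ K′∈F′ K≢K′ with insert-cases F J K K∈F′ | insert-cases F J K′ K′∈F′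
    ... | inj₁ K∈F                  | inj₁ K′∈F                  = F-intersecting K K′ K∈F K′∈F K≢K′
    ... | inj₂ (≡.refl , _ , meets) | inj₁ K′∈F                  = meets K′ K′∈F K≢K′
    ... | inj₁ K∈F                  | inj₂ (≡.refl , _ , meets)  =
      ≡.subst Nonempty (∩-comm K′ K) (meets K K∈F (K≢K′ ∘ ≡.sym))
    ... | inj₂ (≡.refl , _)         | inj₂ (≡.refl , _)          = contradiction ≡.refl K≢K′

  compatible-below : ∀ {F F′ J} → IntersectingOnSG c F′ → F ⊆F F′ → J ∈F F′ → Compatible F J
  compatible-below (F′⊆SG , F′-intersecting) F⊆F′ J∈F′ =
    F′⊆SG _ J∈F′ , λ K K∈F → F′-intersecting _ K J∈F′ (F⊆F′ K K∈F)

  greedy : Family m → List (Subset m) → Family m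
  greedy F []       = F
  greedy F (J ∷ Js) = greedy (insertIfCompatible F J) Js

  greedy-⊇ : ∀ F Js → F ⊆F greedy F Js
  greedy-⊇ F []       K K∈F = K∈F
  greedy-⊇ F (J ∷ Js) K K∈F = greedy-⊇ (insertIfCompatible F J) Js K (insert-⊇ F J K K∈F)

  greedy-intersectingOnSG : ∀ {F} Js → IntersectingOnSG c F → IntersectingOnSG c (greedy F Js)
  greedy-intersectingOnSG []       F-int = F-int
  greedy-intersectingOnSG (J ∷ Js) F-int = greedy-intersectingOnSG Js (insert-intersectingOnSG J F-int)

  -- A J rejected at its turn conflicts with a member already present, and members are never removed.
  greedy-maximal : ∀ F Js {F′ J} → IntersectingOnSG c F′ → greedy F Js ⊆F F′ →
                   Any (J ≡_) Js → J ∈F F′ → J ∈F greedy F Js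
  greedy-maximal F (J ∷ Js) F′-int greedy⊆F′ (here ≡.refl) J∈F′ =
    greedy-⊇ (insertIfCompatible F J) Js J J∈insert
    where
    F⊆F′ : F ⊆F _
    F⊆F′ K = greedy⊆F′ K ∘ greedy-⊇ (insertIfCompatible F J) Js K ∘ insert-⊇ F J K
    J∈insert : J ∈F insertIfCompatible F J
    J∈insert rewrite dec-true (J ≟ˢ J) ≡.refl | dec-true (compatible? F J) (compatible-below F′-int F⊆F′ J∈F′) =
      Bool.∨-zeroʳ (F J)
  greedy-maximal F (_ ∷ Js) F′-int greedy⊆F′ (there J∈Js) J∈F′ =
    greedy-maximal _ Js F′-int greedy⊆F′ J∈Js J∈F′

  extend-to-maximal : ∀ {F} → IntersectingOnSG c F → ∃ λ G → MaximalIntersecting c G × F ⊆F G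
  extend-to-maximal {F} F-int =
    greedy F (allSubsets m) ,
    (greedy-intersectingOnSG (allSubsets m) F-int ,
     λ F′ F′-int greedy⊆F′ J → greedy-maximal F (allSubsets m) F′-int greedy⊆F′ (∈-allSubsets J)) ,
    greedy-⊇ F (allSubsets m)

  clique⊇⇔ : ∀ {H K} → (IsCliqueOfU c K × H ⊆ K) ⇔ (H ⊆ K × ∃ λ F → InMH c H F × K ⊆ ⋃Γ F)
  clique⊇⇔ {H} {K} = mk⇔ to from
    where
    to : IsCliqueOfU c K × H ⊆ K → H ⊆ K × ∃ λ F → InMH c H F × K ⊆ ⋃Γ F
    to (K-clique , H⊆K) with G , G-maximal , SuppK⊆G ← extend-to-maximal (Supp⊆SG K , Supp-intersecting K-clique) =
      H⊆K , G , (G-maximal , λ J → SuppK⊆G J ∘ Supp-mono H⊆K J) , ⋃Γ-mono SuppK⊆G ∘ ⊆-⋃Γ-Supp (proj₁ K-clique)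
    from : H ⊆ K × (∃ λ F → InMH c H F × K ⊆ ⋃Γ F) → IsCliqueOfU c K × H ⊆ K
    from (H⊆K , F , (((_ , F-intersecting) , _) , _) , K⊆⋃ΓF) = ⊆⋃Γ⇒clique F-intersecting K⊆⋃ΓF , H⊆K

  ⊆-⋃Γ-InMH : ∀ {H F} → H ⊆ V c → InMH c H F → H ⊆ ⋃Γ F
  ⊆-⋃Γ-InMH H⊆V (_ , SuppH⊆F) = ⋃Γ-mono SuppH⊆F ∘ ⊆-⋃Γ-Supp H⊆V

  -- Each vertex v of V lies in exactly one Γ_J, namely for J = pattern′ c v.
  N≡∣⋃Γ∣ : ∀ F → N c F ≡ ∣ ⋃Γ F ∣
  N≡∣⋃Γ∣ F = begin
    ∑ℕ S (λ J → if F J then γ c J else 0)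
      ≡⟨ ℕ∑.∑-cong (λ J → γ-as-∑ (F J) J) S ⟩
    ∑ℕ S (λ J → ∑ℕ vs (λ v → 𝟙 (F J ∧ inΓ v J)))
      ≡⟨ ℕ∑.∑-comm S vs _ ⟩
    ∑ℕ vs (λ v → ∑ℕ S (λ J → 𝟙 (F J ∧ inΓ v J)))
      ≡⟨ ℕ∑.∑-cong (λ v → ≡.trans (ℕ∑.∑-cong (reassoc v) S) (∑-select (λ J → F J ∧ inV v) (pattern′ c v))) vs ⟩
    ∑ℕ vs (λ v → 𝟙 (F (pattern′ c v) ∧ inV v))
      ≡⟨ ℕ∑.∑-cong (λ v → ≡.cong 𝟙 (Bool.∧-comm (F (pattern′ c v)) (inV v))) vs ⟩
    ∑ℕ vs (λ v → 𝟙 (inV v ∧ F (pattern′ c v)))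
      ≡⟨ ∣tabulate∣ (λ v → inV v ∧ F (pattern′ c v)) ⟨
    ∣ ⋃Γ F ∣
      ∎
    where
    S = allSubsets m
    vs = allFin n
    inV : Fin n → Bool
    inV v = isYes (v ∈? V c)
    inΓ : Fin n → Subset m → Bool
    inΓ v J = inV v ∧ isYes (≡-dec Bool._≟_ (pattern′ c v) J)
    γ-as-∑ : ∀ b J → (if b then γ c J else 0) ≡ ∑ℕ vs (λ v → 𝟙 (b ∧ inΓ v J))
    γ-as-∑ true  J = ∣tabulate∣ (λ v → inΓ v J)
    γ-as-∑ false J = ≡.sym (ℕ∑.∑-zero vs)
    reassoc : ∀ v J → 𝟙 (F J ∧ inΓ v J) ≡ 𝟙 ((F J ∧ inV v) ∧ does (pattern′ c v ≟ˢ J))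
    reassoc v J = ≡.cong 𝟙 (≡.trans (≡.cong (λ b → F J ∧ (inV v ∧ b)) (isYes≗does (pattern′ c v ≟ˢ J)))
                                    (≡.sym (Bool.∧-assoc (F J) (inV v) _)))

  ⊆ᵇ-⋃Γ-⋂F : ∀ K F Fs → K ⊆ᵇ ⋃Γ (⋂F (F ∷ Fs)) ≡ all (λ G → K ⊆ᵇ ⋃Γ G) (F ∷ Fs)
  ⊆ᵇ-⋃Γ-⋂F K F []       = ≡.trans (≡.cong (K ⊆ᵇ_) (⋃Γ-cong (Bool.∧-identityʳ ∘ F))) (≡.sym (Bool.∧-identityʳ _))
  ⊆ᵇ-⋃Γ-⋂F K F (G ∷ Gs) = begin
    K ⊆ᵇ ⋃Γ (λ J → F J ∧ ⋂F (G ∷ Gs) J)            ≡⟨ ≡.cong (K ⊆ᵇ_) (⋃Γ-∧ F (⋂F (G ∷ Gs))) ⟩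
    K ⊆ᵇ (⋃Γ F ∩ ⋃Γ (⋂F (G ∷ Gs)))                  ≡⟨ ⊆ᵇ-∩ K (⋃Γ F) _ ⟩
    K ⊆ᵇ ⋃Γ F ∧ K ⊆ᵇ ⋃Γ (⋂F (G ∷ Gs))               ≡⟨ ≡.cong (K ⊆ᵇ ⋃Γ F ∧_) (⊆ᵇ-⋃Γ-⋂F K G Gs) ⟩
    K ⊆ᵇ ⋃Γ F ∧ all (λ G → K ⊆ᵇ ⋃Γ G) (G ∷ Gs)      ∎

  term-as-∑ : ∀ {H} F Fs → All (λ G → H ⊆ ⋃Γ G) (F ∷ Fs) →
    term c H (F ∷ Fs) ≡
      ∑ (allSubsets n) (λ K → + 𝟙 (H ⊆ᵇ K) * ieTerm (λ G → K ⊆ᵇ ⋃Γ G) (F ∷ Fs)) - ieTerm (const true) (F ∷ Fs)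
  term-as-∑ {H} F Fs H⊆⋃Γ = begin
    s * (+ (2 ℕ.^ (N c ⋂Js ℕ.∸ ∣ H ∣)) - + 1)
      ≡⟨ ≡.cong (λ k → s * (+ k - + 1)) count ⟩
    s * (+ ∑ℕ S (λ K → 𝟙 (H ⊆ᵇ K ∧ K ⊆ᵇ ⋃Γ ⋂Js)) - + 1)
      ≡⟨ ≡.cong (λ k → s * (k - + 1)) (+-∑ℕ S _) ⟩
    s * (∑ S (λ K → + 𝟙 (H ⊆ᵇ K ∧ K ⊆ᵇ ⋃Γ ⋂Js)) - + 1)
      ≡⟨ *-distribˡ-minus s _ (+ 1) ⟩
    s * ∑ S (λ K → + 𝟙 (H ⊆ᵇ K ∧ K ⊆ᵇ ⋃Γ ⋂Js)) - s * + 1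
      ≡⟨ ≡.cong₂ _-_ (≡.trans (∑-*ˡ s S _) (ℤ∑.∑-cong split S))
                     (≡.cong (λ b → s * + 𝟙 b) (≡.sym (all-true (F ∷ Fs)))) ⟩
    ∑ S (λ K → + 𝟙 (H ⊆ᵇ K) * (s * + 𝟙 (all (λ G → K ⊆ᵇ ⋃Γ G) (F ∷ Fs)))) - s * + 𝟙 (all (const true) (F ∷ Fs))
      ∎
    where
    S = allSubsets n
    ⋂Js = ⋂F (F ∷ Fs)
    s = -1ℤ ^ (length (F ∷ Fs) ℕ.+ 1)
    *-distribˡ-minus : ∀ x y z → x * (y - z) ≡ x * y - x * z
    *-distribˡ-minus = solve-∀
    H⊆⋃Γ⋂ : H ⊆ ⋃Γ ⋂Js
    H⊆⋃Γ⋂ = Equivalence.to (T-does⇔ (H ⊆? ⋃Γ ⋂Js))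
             (≡.subst T (≡.sym (⊆ᵇ-⋃Γ-⋂F H F Fs)) (All⇒all (All.map (Equivalence.from (T-does⇔ (H ⊆? _))) H⊆⋃Γ)))
    count : 2 ℕ.^ (N c ⋂Js ℕ.∸ ∣ H ∣) ≡ ∑ℕ S (λ K → 𝟙 (H ⊆ᵇ K ∧ K ⊆ᵇ ⋃Γ ⋂Js))
    count = ≡.trans (≡.cong (λ k → 2 ℕ.^ (k ℕ.∸ ∣ H ∣)) (N≡∣⋃Γ∣ ⋂Js)) (≡.sym (count-between H (⋃Γ ⋂Js) H⊆⋃Γ⋂))
    swap : ∀ x y z → x * (y * z) ≡ y * (x * z)
    swap = solve-∀
    split : ∀ K → s * + 𝟙 (H ⊆ᵇ K ∧ K ⊆ᵇ ⋃Γ ⋂Js) ≡ + 𝟙 (H ⊆ᵇ K) * (s * + 𝟙 (all (λ G → K ⊆ᵇ ⋃Γ G) (F ∷ Fs)))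
    split K = begin
      s * + 𝟙 (H ⊆ᵇ K ∧ K ⊆ᵇ ⋃Γ ⋂Js)
        ≡⟨ ≡.cong (s *_) (+𝟙-∧ (H ⊆ᵇ K) _) ⟩
      s * (+ 𝟙 (H ⊆ᵇ K) * + 𝟙 (K ⊆ᵇ ⋃Γ ⋂Js))
        ≡⟨ ≡.cong (λ b → s * (+ 𝟙 (H ⊆ᵇ K) * + 𝟙 b)) (⊆ᵇ-⋃Γ-⋂F K F Fs) ⟩
      s * (+ 𝟙 (H ⊆ᵇ K) * + 𝟙 (all (λ G → K ⊆ᵇ ⋃Γ G) (F ∷ Fs)))
        ≡⟨ swap s (+ 𝟙 (H ⊆ᵇ K)) _ ⟩
      + 𝟙 (H ⊆ᵇ K) * (s * + 𝟙 (all (λ G → K ⊆ᵇ ⋃Γ G) (F ∷ Fs)))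
        ∎

  formula≡∑ : ∀ {H} Ms → All (λ G → H ⊆ ⋃Γ G) Ms → Ms ≢ [] →
    formula c H Ms ≡ ∑ (allSubsets n) (λ K → + 𝟙 (H ⊆ᵇ K) * + 𝟙 (any (λ G → K ⊆ᵇ ⋃Γ G) Ms))
  formula≡∑ {H} Ms H⊆⋃Γ Ms≢[] = begin
    formula c H Ms
      ≡⟨ ℤ∑.foldr≈∑ _ nonemptyTerm (λ { [] _ → ≡.refl ; (_ ∷ _) _ → ≡.refl }) (+ 1) Jss ⟩
    ∑ Jss nonemptyTerm + + 1
      ≡⟨ ≡.cong (_+ + 1) (ℤ∑.∑-congᴬ (All.map (λ {Js} → nonemptyTerm-as-∑ Js) (All-subseqs H⊆⋃Γ))) ⟩
    ∑ Jss (λ Js → ∑ S (λ K → a K * ieTerm (p K) Js) - ieTerm (const true) Js) + + 1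
      ≡⟨ ≡.cong (_+ + 1) (∑-- Jss _ (ieTerm (const true))) ⟩
    ∑ Jss (λ Js → ∑ S (λ K → a K * ieTerm (p K) Js)) - ∑ Jss (ieTerm (const true)) + + 1
      ≡⟨ ≡.cong (λ x → x - ∑ Jss (ieTerm (const true)) + + 1) (ℤ∑.∑-comm Jss S _) ⟩
    ∑ S (λ K → ∑ Jss (λ Js → a K * ieTerm (p K) Js)) - ∑ Jss (ieTerm (const true)) + + 1
      ≡⟨ ≡.cong₂ (λ x y → x - y + + 1)
           (ℤ∑.∑-cong (λ K → ≡.trans (≡.sym (∑-*ˡ (a K) Jss (ieTerm (p K))))
                                      (≡.cong (a K *_) (inclusion-exclusion (p K) Ms))) S)
           (≡.trans (inclusion-exclusion (const true) Ms) (any-true Ms Ms≢[])) ⟩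
    ∑ S (λ K → a K * + 𝟙 (any (p K) Ms)) - + 1 + + 1
      ≡⟨ cancel _ ⟩
    ∑ S (λ K → a K * + 𝟙 (any (p K) Ms))
      ∎
    where
    S = allSubsets n
    Jss = subseqs Ms
    a : Subset n → ℤ
    a K = + 𝟙 (H ⊆ᵇ K)
    p : Subset n → Family m → Bool
    p K G = K ⊆ᵇ ⋃Γ G
    -- the summand of `formula`, which is local to its definition and so cannot be referred to
    nonemptyTerm : List (Family m) → ℤ
    nonemptyTerm []         = 0ℤ
    nonemptyTerm Js@(_ ∷ _) = term c H Js
    nonemptyTerm-as-∑ : ∀ Js → All (λ G → H ⊆ ⋃Γ G) Js →
      nonemptyTerm Js ≡ ∑ S (λ K → a K * ieTerm (p K) Js) - ieTerm (const true) Js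
    nonemptyTerm-as-∑ []       _   = ≡.sym (≡.cong (_- 0ℤ) (≡.trans (ℤ∑.∑-cong (ℤ.*-zeroʳ ∘ a) S) (ℤ∑.∑-zero S)))
    nonemptyTerm-as-∑ (F ∷ Fs) H⊆⋃Γ = term-as-∑ F Fs H⊆⋃Γ
    any-true : ∀ (xs : List (Family m)) → xs ≢ [] → + 𝟙 (any (const true) xs) ≡ + 1
    any-true []      []≢[] = contradiction ≡.refl []≢[]
    any-true (_ ∷ _) _     = ≡.refl
    cancel : ∀ x → x - + 1 + + 1 ≡ x
    cancel = solve-∀

  module _ {H : Subset n} {Ms : List (Family m)} (Ms⇔ : ∀ F → InMH c H F ⇔ Any (λ G → F ≗ G) Ms) where

    All-InMH : All (InMH c H) Ms
    All-InMH = All.tabulate λ G∈Ms → Equivalence.from (Ms⇔ _) (Any.map (λ { ≡.refl _ → ≡.refl }) G∈Ms)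

    InMH⇔any : ∀ {K} → (∃ λ F → InMH c H F × K ⊆ ⋃Γ F) ⇔ T (any (λ G → K ⊆ᵇ ⋃Γ G) Ms)
    InMH⇔any {K} = mk⇔ to from
      where
      to : (∃ λ F → InMH c H F × K ⊆ ⋃Γ F) → T (any (λ G → K ⊆ᵇ ⋃Γ G) Ms)
      to (F , F∈MH , K⊆⋃ΓF) = Any.any⁺ _ (Any.map K⊆⋃Γ (Equivalence.to (Ms⇔ F) F∈MH))
        where
        K⊆⋃Γ : ∀ {G} → F ≗ G → T (K ⊆ᵇ ⋃Γ G)
        K⊆⋃Γ F≗G = Equivalence.from (T-does⇔ (K ⊆? _)) (≡.subst (K ⊆_) (⋃Γ-cong F≗G) K⊆⋃ΓF)
      from : T (any (λ G → K ⊆ᵇ ⋃Γ G) Ms) → ∃ λ F → InMH c H F × K ⊆ ⋃Γ F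
      from K⊆some with G , G∈Ms , K⊆ᵇ⋃ΓG ← find (Any.any⁻ _ Ms K⊆some) =
        G , All.lookup All-InMH G∈Ms , Equivalence.to (T-does⇔ (K ⊆? ⋃Γ G)) K⊆ᵇ⋃ΓG

open import Data.List.Membership.Propositional using (_∈_)

proposition5p1 : (m n : ℕ) (c : Fin m → Subset n) (H : Subset n) →
    IsCliqueOfU c H →
    (cliques : List (Subset n)) → Unique cliques →
    (∀ K → (K ∈ cliques) ⇔ (IsCliqueOfU c K × H ⊆ K)) →
    (Ms : List (Family m)) → AllPairs (λ F G → ¬ (F ≗ G)) Ms →
    (∀ F → InMH c H F ⇔ Any (λ G → F ≗ G) Ms) →
    + (length cliques) ≡ formula c H Ms
-- Inclusion–exclusion over sub-lists is valid for lists with repetitions: Ms need not be distinct.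
proposition5p1 m n c H H-clique cliques unique cliques⇔ Ms _ Ms⇔ = begin
  + length cliques
    ≡⟨ ≡.cong +_ (length-unique unique Q membership) ⟩
  + ∑ℕ S (𝟙 ∘ Q)
    ≡⟨ +-∑ℕ S (𝟙 ∘ Q) ⟩
  ∑ S (λ K → + 𝟙 (Q K))
    ≡⟨ ℤ∑.∑-cong (λ K → +𝟙-∧ (H ⊆ᵇ K) _) S ⟩
  ∑ S (λ K → + 𝟙 (H ⊆ᵇ K) * + 𝟙 (any (λ G → K ⊆ᵇ ⋃Γ c G) Ms))
    ≡⟨ formula≡∑ c Ms (All.map (⊆-⋃Γ-InMH c (proj₁ H-clique)) (All-InMH c Ms⇔)) Ms≢[] ⟨
  formula c H Ms
    ∎
  where
  S = allSubsets n
  Q : Subset n → Bool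
  Q K = H ⊆ᵇ K ∧ any (λ G → K ⊆ᵇ ⋃Γ c G) Ms
  membership : ∀ K → K ∈ cliques ⇔ T (Q K)
  membership K = ⇔.trans (cliques⇔ K) (⇔.trans (clique⊇⇔ c)
                   (⇔.trans (⇔.sym (T-does⇔ (H ⊆? K)) ×-⇔ InMH⇔any c Ms⇔) (⇔.sym Bool.T-∧)))
  Ms≢[] : Ms ≢ []
  Ms≢[] ≡.refl with _ , _ , F∈MH , _ ← Equivalence.to (clique⊇⇔ c) (H-clique , id)
    with () ← Equivalence.to (Ms⇔ _) F∈MH
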